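{- Let $1<c<2$, and let $n,p$ be positive integers. Let $A$ be a deterministic $p$-pass streaming algorithm that, on every data stream of length $2n$ with tokens from the universe $\{1,2,\ldots,2n\}$, outputs a number $E$ satisfying $F_0 \le E < cF_0$, where $F_0$ is the number of distinct elements in the stream. Then $A$ uses space $\Omega\left(\frac{n(2-c)^2}{p}\right)$ (bits of memory), with the hidden constant absolute (independent of $n$, $p$, $c$).
   Context: A data stream is a sequence of tokens; a deterministic $p$-pass streaming algorithm reads the stream sequentially from beginning to end $p$ times, maintaining only its memory state (of $S$ bits, its space) between tokens, and produces an output after the last pass. $F_0$ of a stream denotes the number of distinct tokens occurring in it.
   Formalization: The parameter c ranges over the rationals, and the algorithm's output E takes rational values. -}

module Defs where

open import Data.Nat using (ℕ; zero; suc; _*_; _^_)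
open import Data.Fin using (Fin)
open import Data.Fin.Properties using (_≟_)
open import Data.List using (List; []; _∷_; length; deduplicate)
open import Data.Vec using (Vec; toList)
open import Data.Integer using (+_)
open import Data.Rational using (ℚ; _/_)

toℚ : ℕ → ℚ
toℚ n = + n / 1

-- A stream of length m over the universe {1,…,u}, tokens encoded as Fin u.
Stream : ℕ → ℕ → Set
Stream u m = Vec (Fin u) m

F0 : ∀ {u m} → Stream u m → ℕ
F0 σ = length (deduplicate _≟_ (toList σ))

-- A deterministic p-pass streaming algorithm with S bits of memory
-- (memory states = Fin (2 ^ S)) on tokens from Fin u.
-- The transition may depend on the pass number and on the position in
-- the stream (non-uniform model; this only gives the algorithm more power).
record StreamAlg (p S u : ℕ) : Set where
  field
    init : Fin (2 ^ S)
    step : (pass : ℕ) → (pos : ℕ) → Fin (2 ^ S) → Fin u → Fin (2 ^ S)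
    out  : Fin (2 ^ S) → ℚ

runPass : ∀ {St T : Set} → (ℕ → St → T → St) → ℕ → St → List T → St
runPass δ i s [] = s
runPass δ i s (x ∷ xs) = runPass δ (suc i) (δ i s x) xs

runPasses : ∀ {St T : Set} → ℕ → (ℕ → ℕ → St → T → St) → St → List T → St
runPasses zero δ s xs = s
runPasses (suc k) δ s xs = runPasses k (λ j → δ (suc j)) (runPass (δ 0) 0 s xs) xs

output : ∀ {p S u m} → StreamAlg p S u → Stream u m → ℚ
output {p} A σ = StreamAlg.out A (runPasses p (StreamAlg.step A) (StreamAlg.init A) (toList σ))

-- Fooling set.  Fix m with 2 ≤ m (2 - c) ≤ 3, and put q = 2m - 1, r = ⌊(n - 1) / m²⌋, k = m r.  A word
-- w ∈ [q]ᵏ becomes a half-stream of length n: a blank token, the k tokens (i, wᵢ), then blank padding.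
-- Doubling it gives a stream with at most k + 1 distinct tokens, while pairing the halves of w and w₀ gives
-- one with 2k + 1 - agreement(w, w₀).  If the states at the middle and at the end of every pass coincide on
-- the doubled streams of w and w₀ (same fingerprint), the algorithm answers alike on the paired and the doubled
-- stream, and since c < 2 the words must agree in at least 2r positions.  At most (q + 1)ᵏ / 2²ʳ words agree
-- that much with a given one, so the 2^(2pS) fingerprints cover at most 2^(2pS - 2r) (q + 1)ᵏ ≤ 2^(2pS - r) qᵏ
-- words: r ≤ 2pS.  Thus n ≤ (2pS + 1) m² ≤ 3pS m², and m (2 - c) ≤ 3 gives n (2 - c)² ≤ 27 S p.

module Submission where

open import Defs
open import Data.Nat using (ℕ)

module NatEmbedding where

  open import Data.Nat as ℕ using (ℕ)
  open import Data.Integer as ℤ using (+_; +≤+)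
  import Data.Integer.Properties as ℤ
  open import Data.Rational using (_≤_; _+_; _*_; toℚᵘ)
  open import Data.Rational.Properties
  open import Data.Rational.Unnormalised as ℚᵘ using (ℚᵘ; mkℚᵘ; *≡*; *≤*)
  import Data.Rational.Unnormalised.Properties as ℚᵘ
  open import Relation.Binary.PropositionalEquality

  ι : ℕ → ℚᵘ
  ι n = mkℚᵘ (+ n) 0

  toℚᵘ-toℚ : ∀ n → toℚᵘ (toℚ n) ℚᵘ.≃ ι n
  toℚᵘ-toℚ n = toℚᵘ-fromℚᵘ (ι n)

  private
    ι-homo-+ : ∀ a b → ι (a ℕ.+ b) ℚᵘ.≃ ι a ℚᵘ.+ ι b
    ι-homo-+ a b = *≡* (cong (ℤ._* + 1) (trans (ℤ.pos-+ a b)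
      (sym (cong₂ ℤ._+_ (ℤ.*-identityʳ (+ a)) (ℤ.*-identityʳ (+ b))))))

    ι-homo-* : ∀ a b → ι (a ℕ.* b) ℚᵘ.≃ ι a ℚᵘ.* ι b
    ι-homo-* a b = *≡* (cong (ℤ._* + 1) (ℤ.pos-* a b))

    ι-mono-≤ : ∀ {a b} → a ℕ.≤ b → ι a ℚᵘ.≤ ι b
    ι-mono-≤ a≤b = *≤* (ℤ.*-monoʳ-≤-nonNeg (+ 1) (+≤+ a≤b))

    ι-cancel-≤ : ∀ {a b} → ι a ℚᵘ.≤ ι b → a ℕ.≤ b
    ι-cancel-≤ {a} {b} (*≤* le)
      with subst₂ ℤ._≤_ (ℤ.*-identityʳ (+ a)) (ℤ.*-identityʳ (+ b)) le
    ... | +≤+ a≤b = a≤b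

  toℚ-homo-+ : ∀ a b → toℚ (a ℕ.+ b) ≡ toℚ a + toℚ b
  toℚ-homo-+ a b = toℚᵘ-injective (begin-equality
    toℚᵘ (toℚ (a ℕ.+ b))          ≃⟨ toℚᵘ-toℚ (a ℕ.+ b) ⟩
    ι (a ℕ.+ b)                   ≃⟨ ι-homo-+ a b ⟩
    ι a ℚᵘ.+ ι b                  ≃⟨ ℚᵘ.+-cong (toℚᵘ-toℚ a) (toℚᵘ-toℚ b) ⟨
    toℚᵘ (toℚ a) ℚᵘ.+ toℚᵘ (toℚ b) ≃⟨ toℚᵘ-homo-+ (toℚ a) (toℚ b) ⟨
    toℚᵘ (toℚ a + toℚ b)          ∎)
    where open ℚᵘ.≤-Reasoning

  toℚ-homo-* : ∀ a b → toℚ (a ℕ.* b) ≡ toℚ a * toℚ b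
  toℚ-homo-* a b = toℚᵘ-injective (begin-equality
    toℚᵘ (toℚ (a ℕ.* b))          ≃⟨ toℚᵘ-toℚ (a ℕ.* b) ⟩
    ι (a ℕ.* b)                   ≃⟨ ι-homo-* a b ⟩
    ι a ℚᵘ.* ι b                  ≃⟨ ℚᵘ.*-cong (toℚᵘ-toℚ a) (toℚᵘ-toℚ b) ⟨
    toℚᵘ (toℚ a) ℚᵘ.* toℚᵘ (toℚ b) ≃⟨ toℚᵘ-homo-* (toℚ a) (toℚ b) ⟨
    toℚᵘ (toℚ a * toℚ b)          ∎)
    where open ℚᵘ.≤-Reasoning

  toℚ-mono-≤ : ∀ {a b} → a ℕ.≤ b → toℚ a ≤ toℚ b
  toℚ-mono-≤ {a} {b} a≤b = toℚᵘ-cancel-≤ (begin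
    toℚᵘ (toℚ a) ≃⟨ toℚᵘ-toℚ a ⟩
    ι a          ≤⟨ ι-mono-≤ a≤b ⟩
    ι b          ≃⟨ toℚᵘ-toℚ b ⟨
    toℚᵘ (toℚ b) ∎)
    where open ℚᵘ.≤-Reasoning

  toℚ-cancel-≤ : ∀ {a b} → toℚ a ≤ toℚ b → a ℕ.≤ b
  toℚ-cancel-≤ {a} {b} le = ι-cancel-≤ (begin
    ι a          ≃⟨ toℚᵘ-toℚ a ⟨
    toℚᵘ (toℚ a) ≤⟨ toℚᵘ-mono-≤ le ⟩
    toℚᵘ (toℚ b) ≃⟨ toℚᵘ-toℚ b ⟩
    ι b          ∎)
    where open ℚᵘ.≤-Reasoning

module RationalBounds where

  open import Data.Nat as ℕ using (ℕ; zero; suc; z≤n)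
  import Data.Nat.Properties as ℕ
  open import Data.Nat.Coprimality using (Coprime)
  open import Data.Integer as ℤ using (+_; +<+; -[1+_])
  import Data.Integer.Properties as ℤ
  open import Data.Rational
    using (mkℚ; ↧ₙ_; _<_; _≤_; _-_; -_; _+_; _*_; _/_; 0ℚ; 1ℚ; *<*; _≤?_; NonNegative; nonNegative; toℚᵘ)
  open import Data.Rational.Properties
  open import Data.Rational.Solver using (module +-*-Solver)
  import Data.Rational.Unnormalised as ℚᵘ
  import Data.Rational.Unnormalised.Properties as ℚᵘ
  open import Data.Product using (∃-syntax; _×_; _,_)
  open import Data.Empty using (⊥-elim)
  open import Relation.Nullary using (¬_; yes; no)
  open import Relation.Unary using (Decidable)
  open import Relation.Binary.PropositionalEquality
  open +-*-Solver
  open NatEmbedding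

  first-crossing : (P : ℕ → Set) → Decidable P → ¬ P 0 → ∀ b → P b → ∃[ m ] (¬ P m × P (suc m))
  first-crossing P P? ¬P0 zero    Pb = ⊥-elim (¬P0 Pb)
  first-crossing P P? ¬P0 (suc b) Pb with P? b
  ... | yes Pb′ = first-crossing P P? ¬P0 b Pb′
  ... | no ¬Pb′ = b , ¬Pb′ , Pb

  private
    numerator-positive : ∀ a d .{cop : Coprime a (suc d)} → 0ℚ < mkℚ (+ a) d cop → 1 ℕ.≤ a
    numerator-positive a d (*<* lt) with subst (ℤ._<_ _) (ℤ.*-identityʳ (+ a)) lt
    ... | +<+ 0<a = 0<a

    denominator-clears : ∀ a d .{cop : Coprime a (suc d)} → toℚ (suc d) * mkℚ (+ a) d cop ≡ toℚ a
    denominator-clears a d {cop} = toℚᵘ-injective (begin-equality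
      toℚᵘ (toℚ (suc d) * e)                   ≃⟨ toℚᵘ-homo-* (toℚ (suc d)) e ⟩
      toℚᵘ (toℚ (suc d)) ℚᵘ.* ℚᵘ.mkℚᵘ (+ a) d  ≃⟨ ℚᵘ.*-congʳ (toℚᵘ-toℚ (suc d)) ⟩
      ι (suc d) ℚᵘ.* ℚᵘ.mkℚᵘ (+ a) d           ≃⟨ ℚᵘ.*≡* clear ⟩
      ι a                                     ≃⟨ toℚᵘ-toℚ a ⟨
      toℚᵘ (toℚ a)                            ∎)
      where
      open ℚᵘ.≤-Reasoning
      e = mkℚ (+ a) d cop
      clear : (+ suc d ℤ.* + a) ℤ.* + 1 ≡ + a ℤ.* + (suc d ℕ.+ 0)
      clear = trans (ℤ.*-identityʳ _) (trans (ℤ.*-comm (+ suc d) (+ a)) (cong (λ z → + a ℤ.* + z) (sym (ℕ.+-identityʳ (suc d)))))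

  2≤[2↧e]e : ∀ e → 0ℚ < e → toℚ 2 ≤ toℚ (2 ℕ.* ↧ₙ e) * e
  2≤[2↧e]e (mkℚ -[1+ _ ] _ _) (*<* ())
  2≤[2↧e]e e@(mkℚ (+ a) d _) 0<e = begin
    toℚ 2                      ≤⟨ toℚ-mono-≤ (ℕ.*-monoʳ-≤ 2 (numerator-positive a d 0<e)) ⟩
    toℚ (2 ℕ.* a)              ≡⟨ toℚ-homo-* 2 a ⟩
    toℚ 2 * toℚ a              ≡⟨ cong (toℚ 2 *_) (denominator-clears a d) ⟨
    toℚ 2 * (toℚ (suc d) * e)  ≡⟨ *-assoc (toℚ 2) (toℚ (suc d)) e ⟨
    toℚ 2 * toℚ (suc d) * e    ≡⟨ cong (_* e) (toℚ-homo-* 2 (suc d)) ⟨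
    toℚ (2 ℕ.* suc d) * e      ∎
    where open ≤-Reasoning

  choose-scale : ∀ e → 0ℚ < e → e ≤ 1ℚ → ∃[ m ] (toℚ 2 ≤ toℚ (suc m) * e × toℚ (suc m) * e ≤ toℚ 3)
  choose-scale e 0<e e≤1 = scale (first-crossing P P? not-at-0 (2 ℕ.* ↧ₙ e) (2≤[2↧e]e e 0<e))
    where
    P : ℕ → Set
    P t = toℚ 2 ≤ toℚ t * e
    P? : Decidable P
    P? t = toℚ 2 ≤? toℚ t * e
    not-at-0 : ¬ P 0
    not-at-0 le with toℚ-cancel-≤ {2} {0} (≤-trans le (≤-reflexive (*-zeroˡ e)))
    ... | ()
    scale : ∃[ m ] (¬ P m × P (suc m)) → ∃[ m ] (P (suc m) × toℚ (suc m) * e ≤ toℚ 3)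
    scale (m , ¬Pm , Psm) = m , Psm , (begin
      toℚ (suc m) * e     ≡⟨ cong (_* e) (toℚ-homo-+ 1 m) ⟩
      (1ℚ + toℚ m) * e    ≡⟨ *-distribʳ-+ e 1ℚ (toℚ m) ⟩
      1ℚ * e + toℚ m * e  ≤⟨ +-mono-≤ (≤-trans (≤-reflexive (*-identityˡ e)) e≤1) (<⇒≤ (≰⇒> ¬Pm)) ⟩
      1ℚ + toℚ 2          ≡⟨ toℚ-homo-+ 1 2 ⟨
      toℚ 3               ∎)
      where open ≤-Reasoning

  1<c<2⇒0<2-c≤1 : ∀ {c} → 1ℚ < c → c < toℚ 2 → 0ℚ < toℚ 2 - c × toℚ 2 - c ≤ 1ℚ
  1<c<2⇒0<2-c≤1 {c} 1<c c<2 =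
    ≤-<-trans (≤-reflexive (sym (+-inverseʳ c))) (+-monoˡ-< (- c) c<2) ,
    +-monoʳ-≤ (toℚ 2) (<⇒≤ (neg-antimono-< 1<c))

  1<c⇒nonNegative : ∀ {c} → 1ℚ < c → NonNegative c
  1<c⇒nonNegative 1<c = nonNegative (<⇒≤ (≤-<-trans (toℚ-mono-≤ (z≤n {1})) 1<c))

  x<cK∧r≤[2-c]K⇒x+r<2K : ∀ {c K x r} → x < c * K → r ≤ (toℚ 2 - c) * K → x + r < toℚ 2 * K
  x<cK∧r≤[2-c]K⇒x+r<2K {c} {K} {x} {r} x<cK r≤[2-c]K = begin-strict
    x + r                   <⟨ +-mono-<-≤ x<cK r≤[2-c]K ⟩
    c * K + (toℚ 2 - c) * K ≡⟨ solve 3 (λ c K t → c :* K :+ (t :- c) :* K := t :* K) refl c K (toℚ 2) ⟩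
    toℚ 2 * K               ∎
    where open ≤-Reasoning

  2r≤[2-c][mr+1] : ∀ {c m r} → 0ℚ ≤ toℚ 2 - c → toℚ 2 ≤ m * (toℚ 2 - c) → 0ℚ ≤ r →
                   toℚ 2 * r ≤ (toℚ 2 - c) * (m * r + 1ℚ)
  2r≤[2-c][mr+1] {c} {m} {r} 0≤e 2≤me 0≤r = begin
    toℚ 2 * r           ≤⟨ *-monoʳ-≤-nonNeg r 2≤me ⟩
    m * e * r           ≡⟨ +-identityʳ (m * e * r) ⟨
    m * e * r + 0ℚ      ≤⟨ +-monoʳ-≤ (m * e * r) 0≤e ⟩
    m * e * r + e       ≡⟨ solve 3 (λ m e r → m :* e :* r :+ e := e :* (m :* r :+ con 1ℚ)) refl m e r ⟩
    e * (m * r + 1ℚ)    ∎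
    where
    open ≤-Reasoning
    e = toℚ 2 - c
    instance
      _ : NonNegative r
      _ = nonNegative 0≤r

  n≤3Pm²∧me≤3⇒ne²≤27P : ∀ n P m {e} → 0ℚ ≤ e → n ℕ.≤ 3 ℕ.* P ℕ.* (m ℕ.* m) → toℚ m * e ≤ toℚ 3 →
                        (+ 1 / 27) * (toℚ n * (e * e)) ≤ toℚ P
  n≤3Pm²∧me≤3⇒ne²≤27P n P m {e} 0≤e n≤3Pm² me≤3 = begin
    k * (toℚ n * (e * e))
      ≤⟨ *-monoˡ-≤-nonNeg k (*-monoʳ-≤-nonNeg (e * e) n≤) ⟩
    k * (toℚ 3 * toℚ P * (M * M) * (e * e))
      ≡⟨ solve 5 (λ k t P M e → k :* (t :* P :* (M :* M) :* (e :* e)) := k :* t :* P :* ((M :* e) :* (M :* e))) refl k (toℚ 3) (toℚ P) M e ⟩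
    k * toℚ 3 * toℚ P * ((M * e) * (M * e))
      ≤⟨ *-monoˡ-≤-nonNeg (k * toℚ 3 * toℚ P) (≤-trans (*-monoˡ-≤-nonNeg (M * e) me≤3) (*-monoʳ-≤-nonNeg (toℚ 3) me≤3)) ⟩
    k * toℚ 3 * toℚ P * (toℚ 3 * toℚ 3)
      ≡⟨ solve 3 (λ k t P → k :* t :* P :* (t :* t) := k :* t :* t :* t :* P) refl k (toℚ 3) (toℚ P) ⟩
    k * toℚ 3 * toℚ 3 * toℚ 3 * toℚ P
      ≡⟨ *-identityˡ (toℚ P) ⟩
    toℚ P ∎
    where
    open ≤-Reasoning
    k = + 1 / 27
    M = toℚ m
    toℚ-nonNeg : ∀ x → NonNegative (toℚ x)
    toℚ-nonNeg x = nonNegative (toℚ-mono-≤ (z≤n {x}))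
    n≤ : toℚ n ≤ toℚ 3 * toℚ P * (M * M)
    n≤ = ≤-trans (toℚ-mono-≤ n≤3Pm²) (≤-reflexive (trans (toℚ-homo-* (3 ℕ.* P) (m ℕ.* m))
           (cong₂ _*_ (toℚ-homo-* 3 P) (toℚ-homo-* m m))))
    instance
      _ : NonNegative e
      _ = nonNegative 0≤e
      _ : NonNegative (e * e)
      _ = nonNeg*nonNeg⇒nonNeg e e
      _ : NonNegative k
      _ = _
      _ : NonNegative (M * e)
      _ = nonNeg*nonNeg⇒nonNeg M {{toℚ-nonNeg m}} e
      _ : NonNegative (toℚ 3)
      _ = _
      _ : NonNegative (k * toℚ 3 * toℚ P)
      _ = nonNeg*nonNeg⇒nonNeg (k * toℚ 3) (toℚ P) {{toℚ-nonNeg P}}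

module FiniteSums where

  open import Data.Nat
  open import Data.Nat.Properties
  open import Data.Fin using (Fin; zero; suc)
  open import Data.Vec using (Vec; []; _∷_)
  open import Data.Product using (∃-syntax; _×_; _,_)
  open import Data.Sum using (_⊎_; inj₁; inj₂)
  open import Relation.Binary.PropositionalEquality
  open import Function using (_∘_)
  open import Algebra.Properties.CommutativeSemigroup +-commutativeSemigroup using (interchange)

  ∑ : ∀ a → (Fin a → ℕ) → ℕ
  ∑ zero    f = 0
  ∑ (suc a) f = f zero + ∑ a (f ∘ suc)

  ∑-cong : ∀ a {f g : Fin a → ℕ} → (∀ i → f i ≡ g i) → ∑ a f ≡ ∑ a g
  ∑-cong zero    f≗g = refl
  ∑-cong (suc a) f≗g = cong₂ _+_ (f≗g zero) (∑-cong a (f≗g ∘ suc))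

  ∑-mono-≤ : ∀ a {f g : Fin a → ℕ} → (∀ i → f i ≤ g i) → ∑ a f ≤ ∑ a g
  ∑-mono-≤ zero    f≤g = z≤n
  ∑-mono-≤ (suc a) f≤g = +-mono-≤ (f≤g zero) (∑-mono-≤ a (f≤g ∘ suc))

  ∑-const : ∀ a x → ∑ a (λ _ → x) ≡ a * x
  ∑-const zero    x = refl
  ∑-const (suc a) x = cong (x +_) (∑-const a x)

  ∑-distrib-+ : ∀ a (f g : Fin a → ℕ) → ∑ a (λ i → f i + g i) ≡ ∑ a f + ∑ a g
  ∑-distrib-+ zero    f g = refl
  ∑-distrib-+ (suc a) f g = trans (cong (f zero + g zero +_) (∑-distrib-+ a (f ∘ suc) (g ∘ suc)))
                                  (interchange (f zero) (g zero) (∑ a (f ∘ suc)) (∑ a (g ∘ suc)))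

  ∑-distribˡ-* : ∀ a x (f : Fin a → ℕ) → ∑ a (λ i → x * f i) ≡ x * ∑ a f
  ∑-distribˡ-* zero    x f = sym (*-zeroʳ x)
  ∑-distribˡ-* (suc a) x f = trans (cong (x * f zero +_) (∑-distribˡ-* a x (f ∘ suc))) (sym (*-distribˡ-+ x (f zero) _))

  ∑-distribʳ-* : ∀ a x (f : Fin a → ℕ) → ∑ a (λ i → f i * x) ≡ ∑ a f * x
  ∑-distribʳ-* a x f = trans (∑-cong a (λ i → *-comm (f i) x)) (trans (∑-distribˡ-* a x f) (*-comm x _))

  ∑-comm : ∀ a b (f : Fin a → Fin b → ℕ) → ∑ a (λ i → ∑ b (f i)) ≡ ∑ b (λ j → ∑ a (λ i → f i j))
  ∑-comm zero    b f = sym (trans (∑-const b 0) (*-zeroʳ b))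
  ∑-comm (suc a) b f = trans (cong (∑ b (f zero) +_) (∑-comm a b (f ∘ suc)))
                             (sym (∑-distrib-+ b (f zero) (λ j → ∑ a (λ i → f (suc i) j))))

  term≤∑ : ∀ a (f : Fin a → ℕ) i → f i ≤ ∑ a f
  term≤∑ (suc a) f zero    = m≤m+n (f zero) _
  term≤∑ (suc a) f (suc i) = ≤-trans (term≤∑ a (f ∘ suc) i) (m≤n+m _ (f zero))

  ∑-pos⇒∃-pos : ∀ a (f : Fin a → ℕ) → 0 < ∑ a f → ∃[ i ] 0 < f i
  ∑-pos⇒∃-pos (suc a) f pos with f zero in eq
  ... | suc _ = zero , subst (0 <_) (sym eq) z<s
  ... | zero with ∑-pos⇒∃-pos a (f ∘ suc) pos
  ...   | i , fi>0 = suc i , fi>0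

  δ : ∀ {a} → Fin a → Fin a → ℕ
  δ zero    zero    = 1
  δ zero    (suc j) = 0
  δ (suc i) zero    = 0
  δ (suc i) (suc j) = δ i j

  δ-refl : ∀ {a} (i : Fin a) → δ i i ≡ 1
  δ-refl zero    = refl
  δ-refl (suc i) = δ-refl i

  δ-cases : ∀ {a} (i j : Fin a) → δ i j ≡ 0 ⊎ (δ i j ≡ 1 × i ≡ j)
  δ-cases zero    zero    = inj₂ (refl , refl)
  δ-cases zero    (suc j) = inj₁ refl
  δ-cases (suc i) zero    = inj₁ refl
  δ-cases (suc i) (suc j) with δ-cases i j
  ... | inj₁ δ≡0          = inj₁ δ≡0
  ... | inj₂ (δ≡1 , refl) = inj₂ (δ≡1 , refl)

  ∑-δ : ∀ a (j : Fin a) → ∑ a (λ i → δ i j) ≡ 1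
  ∑-δ (suc a) zero    = cong suc (trans (∑-const a 0) (*-zeroʳ a))
  ∑-δ (suc a) (suc j) = ∑-δ a j

  Word : ℕ → ℕ → Set
  Word q k = Vec (Fin q) k

  ∑ᵥ : ∀ q k → (Word q k → ℕ) → ℕ
  ∑ᵥ q zero    f = f []
  ∑ᵥ q (suc k) f = ∑ q (λ a → ∑ᵥ q k (λ w → f (a ∷ w)))

  ∑ᵥ-mono-≤ : ∀ q k {f g : Word q k → ℕ} → (∀ w → f w ≤ g w) → ∑ᵥ q k f ≤ ∑ᵥ q k g
  ∑ᵥ-mono-≤ q zero    f≤g = f≤g []
  ∑ᵥ-mono-≤ q (suc k) f≤g = ∑-mono-≤ q (λ a → ∑ᵥ-mono-≤ q k (λ w → f≤g (a ∷ w)))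

  ∑ᵥ-const : ∀ q k x → ∑ᵥ q k (λ _ → x) ≡ q ^ k * x
  ∑ᵥ-const q zero    x = sym (+-identityʳ x)
  ∑ᵥ-const q (suc k) x = trans (∑-cong q (λ _ → ∑ᵥ-const q k x)) (trans (∑-const q _) (sym (*-assoc q (q ^ k) x)))

  ∑ᵥ-distribˡ-* : ∀ q k x (f : Word q k → ℕ) → ∑ᵥ q k (λ w → x * f w) ≡ x * ∑ᵥ q k f
  ∑ᵥ-distribˡ-* q zero    x f = refl
  ∑ᵥ-distribˡ-* q (suc k) x f = trans (∑-cong q (λ a → ∑ᵥ-distribˡ-* q k x (λ w → f (a ∷ w)))) (∑-distribˡ-* q x _)

  ∑-∑ᵥ-comm : ∀ a q k (f : Fin a → Word q k → ℕ) → ∑ a (λ i → ∑ᵥ q k (f i)) ≡ ∑ᵥ q k (λ w → ∑ a (λ i → f i w))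
  ∑-∑ᵥ-comm a q zero    f = refl
  ∑-∑ᵥ-comm a q (suc k) f = trans (∑-comm a q _) (∑-cong q (λ b → ∑-∑ᵥ-comm a q k (λ i w → f i (b ∷ w))))

  ∑ᵥ-comm : ∀ q k r l (f : Word q k → Word r l → ℕ) →
            ∑ᵥ q k (λ v → ∑ᵥ r l (f v)) ≡ ∑ᵥ r l (λ w → ∑ᵥ q k (λ v → f v w))
  ∑ᵥ-comm q zero    r l f = refl
  ∑ᵥ-comm q (suc k) r l f = trans (∑-cong q (λ a → ∑ᵥ-comm q k r l (λ v → f (a ∷ v)))) (∑-∑ᵥ-comm q r l _)

  term≤∑ᵥ : ∀ q k (f : Word q k → ℕ) w → f w ≤ ∑ᵥ q k f
  term≤∑ᵥ q zero    f []      = ≤-refl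
  term≤∑ᵥ q (suc k) f (a ∷ w) = ≤-trans (term≤∑ᵥ q k (λ v → f (a ∷ v)) w) (term≤∑ q _ a)

  ∑ᵥ-pos⇒∃-pos : ∀ q k (f : Word q k → ℕ) → 0 < ∑ᵥ q k f → ∃[ w ] 0 < f w
  ∑ᵥ-pos⇒∃-pos q zero    f pos = [] , pos
  ∑ᵥ-pos⇒∃-pos q (suc k) f pos with ∑-pos⇒∃-pos q _ pos
  ... | a , pos′ with ∑ᵥ-pos⇒∃-pos q k _ pos′
  ...   | w , fw>0 = a ∷ w , fw>0

  δᵥ : ∀ {q k} → Word q k → Word q k → ℕ
  δᵥ []      []      = 1
  δᵥ (a ∷ v) (b ∷ w) = δ a b * δᵥ v w

  δᵥ-refl : ∀ {q k} (v : Word q k) → δᵥ v v ≡ 1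
  δᵥ-refl []      = refl
  δᵥ-refl (a ∷ v) rewrite δ-refl a | δᵥ-refl v = refl

  δᵥ-cases : ∀ {q k} (v w : Word q k) → δᵥ v w ≡ 0 ⊎ (δᵥ v w ≡ 1 × v ≡ w)
  δᵥ-cases []      []      = inj₂ (refl , refl)
  δᵥ-cases (a ∷ v) (b ∷ w) with δ-cases a b | δᵥ-cases v w
  ... | inj₁ δ≡0          | _                  rewrite δ≡0 = inj₁ refl
  ... | inj₂ (δ≡1 , refl) | inj₁ δᵥ≡0          rewrite δ≡1 | δᵥ≡0 = inj₁ refl
  ... | inj₂ (δ≡1 , refl) | inj₂ (δᵥ≡1 , refl) rewrite δ≡1 | δᵥ≡1 = inj₂ (refl , refl)

module Agreement where

  open import Data.Nat
  open import Data.Nat.Properties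
  open import Data.Fin using (Fin)
  open import Data.Vec using ([]; _∷_)
  open import Data.Product using (_,_)
  open import Data.Sum using (inj₁; inj₂)
  open import Relation.Binary.PropositionalEquality
  open import Relation.Nullary using (contradiction)
  open FiniteSums

  agreement : ∀ {q k} → Word q k → Word q k → ℕ
  agreement []      []      = 0
  agreement (a ∷ v) (b ∷ w) = δ a b + agreement v w

  threshold : ℕ → ℕ → ℕ
  threshold zero    x       = 1
  threshold (suc j) zero    = 0
  threshold (suc j) (suc x) = threshold j x

  threshold-≥ : ∀ {j x} → j ≤ x → threshold j x ≡ 1
  threshold-≥ {zero}  _         = refl
  threshold-≥ {suc j} (s≤s j≤x) = threshold-≥ j≤x

  threshold-suc : ∀ j x → threshold j (suc x) ≤ threshold (j ∸ 1) x
  threshold-suc zero    x = ≤-refl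
  threshold-suc (suc j) x = ≤-refl

  -- Markov's inequality for 2 ^ agreement w w₀, whose sum over all w is (1 + q) ^ k.
  agreement-tail : ∀ q k j (w₀ : Word q k) → 2 ^ j * ∑ᵥ q k (λ w → threshold j (agreement w w₀)) ≤ suc q ^ k
  agreement-tail q zero    zero    [] = ≤-refl
  agreement-tail q zero    (suc j) [] = ≤-trans (≤-reflexive (*-zeroʳ (2 ^ suc j))) z≤n
  agreement-tail q (suc k) j (b ∷ w₀) = begin
    2 ^ j * ∑ q T
      ≡⟨ ∑-distribˡ-* q (2 ^ j) T ⟨
    ∑ q (λ a → 2 ^ j * T a)
      ≤⟨ ∑-mono-≤ q per-letter ⟩
    ∑ q (λ a → Y + δ a b * Y)
      ≡⟨ ∑-distrib-+ q (λ _ → Y) (λ a → δ a b * Y) ⟩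
    ∑ q (λ _ → Y) + ∑ q (λ a → δ a b * Y)
      ≡⟨ cong₂ _+_ (∑-const q Y) (trans (∑-distribʳ-* q Y (λ a → δ a b)) (cong (_* Y) (∑-δ q b))) ⟩
    q * Y + 1 * Y
      ≡⟨ trans (+-comm (q * Y) (1 * Y)) (cong (_+ q * Y) (*-identityˡ Y)) ⟩
    suc q ^ suc k ∎
    where
    open ≤-Reasoning
    Y = suc q ^ k
    T : Fin q → ℕ
    T a = ∑ᵥ q k (λ w → threshold j (δ a b + agreement w w₀))
    per-letter : ∀ a → 2 ^ j * T a ≤ Y + δ a b * Y
    per-letter a with δ-cases a b
    ... | inj₁ δ≡0 rewrite δ≡0 = ≤-trans (agreement-tail q k j w₀) (m≤m+n Y 0)
    ... | inj₂ (δ≡1 , refl) rewrite δ≡1 = begin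
      2 ^ j * ∑ᵥ q k (λ w → threshold j (suc (agreement w w₀)))
        ≤⟨ *-mono-≤ (2^j≤2*2^[j∸1] j) (∑ᵥ-mono-≤ q k (λ w → threshold-suc j _)) ⟩
      2 * 2 ^ (j ∸ 1) * ∑ᵥ q k (λ w → threshold (j ∸ 1) (agreement w w₀))
        ≡⟨ *-assoc 2 (2 ^ (j ∸ 1)) _ ⟩
      2 * (2 ^ (j ∸ 1) * ∑ᵥ q k (λ w → threshold (j ∸ 1) (agreement w w₀)))
        ≤⟨ *-monoʳ-≤ 2 (agreement-tail q k (j ∸ 1) w₀) ⟩
      Y + 1 * Y ∎
      where
      2^j≤2*2^[j∸1] : ∀ j → 2 ^ j ≤ 2 * 2 ^ (j ∸ 1)
      2^j≤2*2^[j∸1] zero    = s≤s z≤n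
      2^j≤2*2^[j∸1] (suc j) = ≤-refl

  agreement-packing : ∀ q k M L j (cls : Word q k → Word M L) →
                      (∀ w w₀ → cls w ≡ cls w₀ → j ≤ agreement w w₀) →
                      2 ^ j * q ^ k ≤ M ^ L * suc q ^ k
  agreement-packing q k M L j cls agree = begin
    2 ^ j * q ^ k
      ≡⟨ cong (2 ^ j *_) (trans (sym (*-identityʳ (q ^ k))) (sym (∑ᵥ-const q k 1))) ⟩
    2 ^ j * ∑ᵥ q k (λ _ → 1)
      ≤⟨ *-monoʳ-≤ (2 ^ j) (∑ᵥ-mono-≤ q k in-own-class) ⟩
    2 ^ j * ∑ᵥ q k (λ w → ∑ᵥ M L (λ c → δᵥ c (cls w)))
      ≡⟨ cong (2 ^ j *_) (∑ᵥ-comm q k M L _) ⟩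
    2 ^ j * ∑ᵥ M L (λ c → ∑ᵥ q k (λ w → δᵥ c (cls w)))
      ≡⟨ ∑ᵥ-distribˡ-* M L (2 ^ j) _ ⟨
    ∑ᵥ M L (λ c → 2 ^ j * ∑ᵥ q k (λ w → δᵥ c (cls w)))
      ≤⟨ ∑ᵥ-mono-≤ M L class-size ⟩
    ∑ᵥ M L (λ _ → suc q ^ k)
      ≡⟨ ∑ᵥ-const M L _ ⟩
    M ^ L * suc q ^ k ∎
    where
    open ≤-Reasoning
    in-own-class : ∀ w → 1 ≤ ∑ᵥ M L (λ c → δᵥ c (cls w))
    in-own-class w = subst (_≤ ∑ᵥ M L (λ c → δᵥ c (cls w))) (δᵥ-refl (cls w)) (term≤∑ᵥ M L (λ c → δᵥ c (cls w)) (cls w))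
    class-size : ∀ c → 2 ^ j * ∑ᵥ q k (λ w → δᵥ c (cls w)) ≤ suc q ^ k
    class-size c with ∑ᵥ q k (λ w → δᵥ c (cls w)) in size
    ... | zero  = ≤-trans (≤-reflexive (*-zeroʳ (2 ^ j))) z≤n
    ... | suc s with ∑ᵥ-pos⇒∃-pos q k (λ w → δᵥ c (cls w)) (subst (0 <_) (sym size) z<s)
    ...   | w₀ , member with δᵥ-cases c (cls w₀)
    ...     | inj₁ δᵥ≡0 = contradiction (subst (0 <_) δᵥ≡0 member) (<-irrefl refl)
    ...     | inj₂ (_ , refl) = begin
      2 ^ j * suc s
        ≡⟨ cong (2 ^ j *_) size ⟨
      2 ^ j * ∑ᵥ q k (λ w → δᵥ (cls w₀) (cls w))
        ≤⟨ *-monoʳ-≤ (2 ^ j) (∑ᵥ-mono-≤ q k agreeing) ⟩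
      2 ^ j * ∑ᵥ q k (λ w → threshold j (agreement w w₀))
        ≤⟨ agreement-tail q k j w₀ ⟩
      suc q ^ k ∎
      where
      agreeing : ∀ w → δᵥ (cls w₀) (cls w) ≤ threshold j (agreement w w₀)
      agreeing w with δᵥ-cases (cls w₀) (cls w)
      ... | inj₁ δᵥ≡0 rewrite δᵥ≡0 = z≤n
      ... | inj₂ (δᵥ≡1 , same) rewrite δᵥ≡1 = ≤-reflexive (sym (threshold-≥ (agree w w₀ (sym same))))

module PowerBounds where

  open import Data.Nat
  open import Data.Nat.Properties
  open import Relation.Binary.PropositionalEquality
  open import Relation.Nullary using (yes; no; contradiction)
  open import Data.Nat.Solver using (module +-*-Solver)
  open +-*-Solver

  ^-distribʳ-* : ∀ a b r → (a * b) ^ r ≡ a ^ r * b ^ r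
  ^-distribʳ-* a b zero    = refl
  ^-distribʳ-* a b (suc r) = trans (cong (a * b *_) (^-distribʳ-* a b r)) ([m*n]*[o*p]≡[m*o]*[n*p] a b (a ^ r) (b ^ r))

  [1+b]^[1+n]≤b^[1+n]+[1+n][1+b]^n : ∀ b n → suc b ^ suc n ≤ b ^ suc n + suc n * suc b ^ n
  [1+b]^[1+n]≤b^[1+n]+[1+n][1+b]^n b zero    = ≤-reflexive (solve 1 (λ b → (con 1 :+ b) :* con 1 := b :* con 1 :+ con 1 :* con 1) refl b)
  [1+b]^[1+n]≤b^[1+n]+[1+n][1+b]^n b (suc n) = begin
    suc b * suc b ^ suc n
      ≤⟨ *-monoʳ-≤ (suc b) ([1+b]^[1+n]≤b^[1+n]+[1+n][1+b]^n b n) ⟩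
    suc b * (b ^ suc n + suc n * suc b ^ n)
      ≡⟨ solve 3 (λ b x y → (con 1 :+ b) :* (x :+ y) := b :* x :+ (x :+ (con 1 :+ b) :* y)) refl b (b ^ suc n) (suc n * suc b ^ n) ⟩
    b ^ suc (suc n) + (b ^ suc n + suc b * (suc n * suc b ^ n))
      ≤⟨ +-monoʳ-≤ (b ^ suc (suc n)) (+-mono-≤ (^-monoˡ-≤ (suc n) (n≤1+n b)) (≤-reflexive (x∙yz≈y∙xz (suc b) (suc n) _))) ⟩
    b ^ suc (suc n) + (suc b ^ suc n + suc n * suc b ^ suc n) ∎
    where
    open ≤-Reasoning
    open import Algebra.Properties.CommutativeSemigroup *-commutativeSemigroup using (x∙yz≈y∙xz)

  -- With q = 2m - 1 the gap term m (q + 1)ᵐ⁻¹ is exactly half of (q + 1)ᵐ.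
  [2m]^m≤2[2m-1]^m : ∀ m′ → suc (suc (2 * m′)) ^ suc m′ ≤ 2 * suc (2 * m′) ^ suc m′
  [2m]^m≤2[2m-1]^m m′ = +-cancelʳ-≤ X X (2 * q ^ suc m′) (begin
    X + X                                  ≡⟨ cong (X +_) (+-identityʳ X) ⟨
    2 * X                                  ≤⟨ *-monoʳ-≤ 2 ([1+b]^[1+n]≤b^[1+n]+[1+n][1+b]^n q m′) ⟩
    2 * (q ^ suc m′ + suc m′ * suc q ^ m′)  ≡⟨ *-distribˡ-+ 2 (q ^ suc m′) _ ⟩
    2 * q ^ suc m′ + 2 * (suc m′ * suc q ^ m′) ≡⟨ cong (2 * q ^ suc m′ +_) half ⟩
    2 * q ^ suc m′ + X                      ∎)
    where
    open ≤-Reasoning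
    q = suc (2 * m′)
    X = suc q ^ suc m′
    half : 2 * (suc m′ * suc q ^ m′) ≡ X
    half = trans (sym (*-assoc 2 (suc m′) _)) (cong (_* suc q ^ m′) (*-suc 2 m′))

  [2m]^[mr]≤2^r[2m-1]^[mr] : ∀ m′ r → suc (suc (2 * m′)) ^ (suc m′ * r) ≤ 2 ^ r * suc (2 * m′) ^ (suc m′ * r)
  [2m]^[mr]≤2^r[2m-1]^[mr] m′ r = begin
    suc q ^ (suc m′ * r)      ≡⟨ ^-*-assoc (suc q) (suc m′) r ⟨
    (suc q ^ suc m′) ^ r      ≤⟨ ^-monoˡ-≤ r ([2m]^m≤2[2m-1]^m m′) ⟩
    (2 * q ^ suc m′) ^ r      ≡⟨ ^-distribʳ-* 2 (q ^ suc m′) r ⟩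
    2 ^ r * (q ^ suc m′) ^ r  ≡⟨ cong (2 ^ r *_) (^-*-assoc q (suc m′) r) ⟩
    2 ^ r * q ^ (suc m′ * r)  ∎
    where
    open ≤-Reasoning
    q = suc (2 * m′)

  2^-cancel-≤ : ∀ {a b} → 2 ^ a ≤ 2 ^ b → a ≤ b
  2^-cancel-≤ {a} {b} 2^a≤2^b with a ≤? b
  ... | yes a≤b = a≤b
  ... | no  a≰b = contradiction 2^a≤2^b (<⇒≱ (^-monoʳ-< 2 (s≤s (s≤s z≤n)) (≰⇒> a≰b)))

module MultiPass {St T : Set} where

  open import Data.Nat using (ℕ; zero; suc; _+_; _*_)
  open import Data.Nat.Properties using (+-suc)
  open import Data.List using (List; []; _∷_; length; _++_)
  open import Data.Vec using (Vec; []; _∷_)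
  open import Data.Vec.Properties using (∷-injective)
  open import Data.Product using (_,_)
  open import Relation.Binary.PropositionalEquality
  open import Function using (_∘_)

  runPass-++ : ∀ (δ : ℕ → St → T → St) i s xs ys →
               runPass δ i s (xs ++ ys) ≡ runPass δ (length xs + i) (runPass δ i s xs) ys
  runPass-++ δ i s []       ys = refl
  runPass-++ δ i s (x ∷ xs) ys = trans (runPass-++ δ (suc i) (δ i s x) xs ys)
    (cong (λ j → runPass δ j (runPass δ (suc i) (δ i s x) xs) ys) (+-suc (length xs) i))

  boundaryStates : ∀ k → (ℕ → ℕ → St → T → St) → St → List T → List T → Vec St (k * 2)
  boundaryStates zero    δ s x y = []
  boundaryStates (suc k) δ s x y = s₁ ∷ s₂ ∷ boundaryStates k (δ ∘ suc) s₂ x y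
    where
    s₁ = runPass (δ 0) 0 s x
    s₂ = runPass (δ 0) (length x + 0) s₁ y

  runPasses-splice : ∀ k δ s (x y x′ y′ : List T) → length x ≡ length x′ →
                     boundaryStates k δ s x y ≡ boundaryStates k δ s x′ y′ →
                     runPasses k δ s (x ++ y′) ≡ runPasses k δ s (x ++ y)
  runPasses-splice zero    δ s x y x′ y′ _     _    = refl
  runPasses-splice (suc k) δ s x y x′ y′ |x|≡|x′| same
    with ∷-injective same
  ... | s₁≡s₁′ , same′ with ∷-injective same′
  ... | s₂≡s₂′ , rest = begin
    runPasses k (δ ∘ suc) (runPass (δ 0) 0 s (x ++ y′)) (x ++ y′)
      ≡⟨ cong (λ t → runPasses k (δ ∘ suc) t (x ++ y′)) first-pass ⟩
    runPasses k (δ ∘ suc) s₂ (x ++ y′)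
      ≡⟨ runPasses-splice k (δ ∘ suc) s₂ x y x′ y′ |x|≡|x′| rest′ ⟩
    runPasses k (δ ∘ suc) s₂ (x ++ y)
      ≡⟨ cong (λ t → runPasses k (δ ∘ suc) t (x ++ y)) (runPass-++ (δ 0) 0 s x y) ⟨
    runPasses k (δ ∘ suc) (runPass (δ 0) 0 s (x ++ y)) (x ++ y)  ∎
    where
    open ≡-Reasoning
    s₂ = runPass (δ 0) (length x + 0) (runPass (δ 0) 0 s x) y
    rest′ : boundaryStates k (δ ∘ suc) s₂ x y ≡ boundaryStates k (δ ∘ suc) s₂ x′ y′
    rest′ = trans rest (cong (λ t → boundaryStates k (δ ∘ suc) t x′ y′) (sym s₂≡s₂′))
    first-pass : runPass (δ 0) 0 s (x ++ y′) ≡ s₂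
    first-pass = trans (runPass-++ (δ 0) 0 s x y′)
      (trans (cong₂ (λ i t → runPass (δ 0) (i + 0) t y′) |x|≡|x′| s₁≡s₁′) (sym s₂≡s₂′))

module DistinctElements where

  open import Data.Nat using (suc; _≤_; z≤n; s≤s)
  open import Data.Vec using (toList)
  open import Data.List using (List; []; _∷_; length; deduplicate)
  open import Data.List.Properties using (length-removeAt′)
  open import Data.List.Membership.Propositional using (_∈_; _─_)
  open import Data.List.Membership.Propositional.Properties using (∈-deduplicate⁻; ∈-deduplicate⁺)
  open import Data.List.Relation.Binary.Subset.Propositional using (_⊆_)
  open import Data.List.Relation.Unary.Any using (here; there)
  import Data.List.Relation.Unary.All as All
  open import Data.List.Relation.Unary.AllPairs using (_∷_)
  open import Data.List.Relation.Unary.Unique.Propositional using (Unique)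
  open import Data.List.Relation.Unary.Unique.DecPropositional.Properties using (deduplicate-!)
  open import Relation.Binary.Definitions using (DecidableEquality)
  open import Relation.Binary.PropositionalEquality
  open import Data.Empty using (⊥-elim)
  open import Function using (_∘′_)

  module _ {A : Set} where

    ∈-─ : ∀ {x y : A} ys (x∈ys : x ∈ ys) → y ∈ ys → y ≢ x → y ∈ ys ─ x∈ys
    ∈-─ (z ∷ ys) (here refl)  (here refl)  y≢x = ⊥-elim (y≢x refl)
    ∈-─ (z ∷ ys) (here refl)  (there y∈ys) y≢x = y∈ys
    ∈-─ (z ∷ ys) (there x∈ys) (here refl)  y≢x = here refl
    ∈-─ (z ∷ ys) (there x∈ys) (there y∈ys) y≢x = there (∈-─ ys x∈ys y∈ys y≢x)

    Unique⇒length-mono-⊆ : ∀ {xs ys : List A} → Unique xs → xs ⊆ ys → length xs ≤ length ys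
    Unique⇒length-mono-⊆ {[]}     _            _      = z≤n
    Unique⇒length-mono-⊆ {x ∷ xs} {ys} (x∉xs ∷ xs!) xs⊆ys =
      subst (suc (length xs) ≤_) (sym (length-removeAt′ ys _))
        (s≤s (Unique⇒length-mono-⊆ xs! λ y∈xs →
          ∈-─ ys x∈ys (xs⊆ys (there y∈xs)) (λ y≡x → All.lookup x∉xs y∈xs (sym y≡x))))
      where x∈ys = xs⊆ys (here refl)

    length-deduplicate-≤ : (_≟_ : DecidableEquality A) {xs ys : List A} →
                           xs ⊆ ys → length (deduplicate _≟_ xs) ≤ length ys
    length-deduplicate-≤ _≟_ {xs} xs⊆ys = Unique⇒length-mono-⊆ (deduplicate-! _≟_ xs) (xs⊆ys ∘′ ∈-deduplicate⁻ _≟_ xs)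

    Unique⇒length-≤-deduplicate : (_≟_ : DecidableEquality A) {xs ys : List A} →
                                  Unique ys → ys ⊆ xs → length ys ≤ length (deduplicate _≟_ xs)
    Unique⇒length-≤-deduplicate _≟_ ys! ys⊆xs = Unique⇒length-mono-⊆ ys! (∈-deduplicate⁺ _≟_ ∘′ ys⊆xs)

  F0-≤ : ∀ {u m} (σ : Stream u m) {ys} → toList σ ⊆ ys → F0 σ ≤ length ys
  F0-≤ σ = length-deduplicate-≤ _

  F0-≥ : ∀ {u m} (σ : Stream u m) {ys} → Unique ys → ys ⊆ toList σ → length ys ≤ F0 σ
  F0-≥ σ = Unique⇒length-≤-deduplicate _


module WordStreams {T : Set} (blank : T) {q : ℕ} where

  open import Data.Nat using (ℕ; zero; suc; _+_)
  open import Data.Nat.Properties using (+-suc)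
  open import Data.Fin using (Fin; zero; suc)
  open import Data.Fin.Properties using (_≟_)
  open import Data.Vec using ([]; _∷_)
  open import Data.List using (List; []; _∷_; length; _++_; replicate)
  open import Data.List.Properties using (length-++; length-replicate)
  open import Data.List.Membership.Propositional using (_∈_)
  open import Data.List.Relation.Binary.Subset.Propositional using (_⊆_)
  open import Data.List.Relation.Unary.Any using (here; there)
  open import Data.List.Relation.Unary.Any.Properties using (++⁺ˡ; ++⁺ʳ; ++⁻)
  import Data.List.Relation.Unary.All as All
  open import Data.List.Relation.Unary.All.Properties using (replicate⁺)
  open import Data.List.Relation.Unary.AllPairs using ([]; _∷_)
  open import Data.List.Relation.Unary.Unique.Propositional using (Unique)
  open import Data.Product using (∃-syntax; _×_; _,_; proj₂)
  open import Data.Sum using (_⊎_; inj₁; inj₂)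
  import Data.Sum as Sum
  open import Relation.Binary.PropositionalEquality
  open import Relation.Nullary using (yes; no; contradiction)
  open import Function using (_∘_)
  open FiniteSums using (Word; δ-refl; δ-cases)
  open Agreement using (agreement)

  Code : ℕ → Set
  Code k = Fin k → Fin q → T

  Injective₂ : ∀ {k} → Code k → Set
  Injective₂ e = ∀ {i a j b} → e i a ≡ e j b → i ≡ j × a ≡ b

  encode : ∀ {k} → Code k → Word q k → List T
  encode e []      = []
  encode e (a ∷ w) = e zero a ∷ encode (e ∘ suc) w

  length-encode : ∀ {k} (e : Code k) w → length (encode e w) ≡ k
  length-encode e []      = refl
  length-encode e (a ∷ w) = cong suc (length-encode (e ∘ suc) w)

  ∈-encode : ∀ {k} (e : Code k) w {x} → x ∈ encode e w → ∃[ i ] ∃[ a ] x ≡ e i a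
  ∈-encode e (a ∷ w) (here refl) = zero , a , refl
  ∈-encode e (a ∷ w) (there x∈) with ∈-encode (e ∘ suc) w x∈
  ... | i , b , refl = suc i , b , refl

  block : ∀ {k} → Code k → Word q k → ℕ → List T
  block e w padding = blank ∷ (encode e w ++ replicate padding blank)

  length-block : ∀ {k} (e : Code k) w padding → length (block e w padding) ≡ suc (k + padding)
  length-block e w padding = cong suc (trans (length-++ (encode e w)) (cong₂ _+_ (length-encode e w) (length-replicate padding)))

  block-⊆ : ∀ {k} (e : Code k) w padding → block e w padding ⊆ blank ∷ encode e w
  block-⊆ e w padding (here refl) = here refl
  block-⊆ e w padding (there x∈) with ++⁻ (encode e w) x∈
  ... | inj₁ x∈w   = there x∈w
  ... | inj₂ x∈pad = here (All.lookup (replicate⁺ {P = _≡ blank} padding refl) x∈pad)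

  block-++-block-⊆ : ∀ {k} (e : Code k) w padding → block e w padding ++ block e w padding ⊆ blank ∷ encode e w
  block-++-block-⊆ e w padding x∈ with ++⁻ (block e w padding) x∈
  ... | inj₁ x∈ˡ = block-⊆ e w padding x∈ˡ
  ... | inj₂ x∈ʳ = block-⊆ e w padding x∈ʳ

  merged : ∀ {k} → Code k → Word q k → Word q k → List T
  merged e []      []       = []
  merged e (a ∷ w) (b ∷ w₀) with a ≟ b
  ... | yes _ = e zero a ∷ merged (e ∘ suc) w w₀
  ... | no  _ = e zero a ∷ e zero b ∷ merged (e ∘ suc) w w₀

  length-merged : ∀ {k} (e : Code k) w w₀ → length (merged e w w₀) + agreement w w₀ ≡ k + k
  length-merged e [] [] = refl
  length-merged {suc k} e (a ∷ w) (b ∷ w₀) with a ≟ b | δ-cases a b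
  ... | yes refl | _ rewrite δ-refl a = cong suc (begin
    length (merged (e ∘ suc) w w₀) + suc (agreement w w₀)  ≡⟨ +-suc _ _ ⟩
    suc (length (merged (e ∘ suc) w w₀) + agreement w w₀)  ≡⟨ cong suc (length-merged (e ∘ suc) w w₀) ⟩
    suc (k + k)                                            ≡⟨ +-suc k k ⟨
    k + suc k                                              ∎)
    where open ≡-Reasoning
  ... | no a≢b | inj₂ (_ , a≡b) = contradiction a≡b a≢b
  ... | no a≢b | inj₁ δ≡0 rewrite δ≡0 = cong suc (trans (cong suc (length-merged (e ∘ suc) w w₀)) (sym (+-suc k k)))

  merged-⊆ : ∀ {k} (e : Code k) w w₀ {x} → x ∈ merged e w w₀ → x ∈ encode e w ⊎ x ∈ encode e w₀
  merged-⊆ e []      []       ()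
  merged-⊆ e (a ∷ w) (b ∷ w₀) x∈ with a ≟ b | x∈
  ... | yes _ | here refl       = inj₁ (here refl)
  ... | no  _ | here refl       = inj₁ (here refl)
  ... | no  _ | there (here refl) = inj₂ (here refl)
  ... | yes _ | there x∈′ = Sum.map there there (merged-⊆ (e ∘ suc) w w₀ x∈′)
  ... | no  _ | there (there x∈′) = Sum.map there there (merged-⊆ (e ∘ suc) w w₀ x∈′)

  ∈-merged : ∀ {k} (e : Code k) w w₀ {x} → x ∈ merged e w w₀ → ∃[ i ] ∃[ a ] x ≡ e i a
  ∈-merged e w w₀ x∈ with merged-⊆ e w w₀ x∈
  ... | inj₁ x∈w  = ∈-encode e w x∈w
  ... | inj₂ x∈w₀ = ∈-encode e w₀ x∈w₀

  Injective₂-suc : ∀ {k} {e : Code (suc k)} → Injective₂ e → Injective₂ (e ∘ suc)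
  Injective₂-suc inj eq with inj eq
  ... | refl , a≡b = refl , a≡b

  fresh-in-merged : ∀ {k} {e : Code (suc k)} → Injective₂ e → ∀ c w w₀ {x} → x ∈ merged (e ∘ suc) w w₀ → e zero c ≢ x
  fresh-in-merged {e = e} inj c w w₀ x∈ eq with ∈-merged (e ∘ suc) w w₀ x∈
  ... | i , d , refl with inj eq
  ... | () , _

  merged-unique : ∀ {k} (e : Code k) → Injective₂ e → ∀ w w₀ → Unique (merged e w w₀)
  merged-unique e inj [] [] = []
  merged-unique e inj (a ∷ w) (b ∷ w₀) with a ≟ b
  ... | yes _ = All.tabulate (fresh-in-merged inj a w w₀)
              ∷ merged-unique (e ∘ suc) (Injective₂-suc inj) w w₀
  ... | no a≢b = All.tabulate (λ { (here refl) eq → a≢b (proj₂ (inj eq)) ; (there x∈) → fresh-in-merged inj a w w₀ x∈ })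
               ∷ All.tabulate (fresh-in-merged inj b w w₀)
               ∷ merged-unique (e ∘ suc) (Injective₂-suc inj) w w₀

  blank∷merged-unique : ∀ {k} (e : Code k) → Injective₂ e → (∀ i a → e i a ≢ blank) →
                        ∀ w w₀ → Unique (blank ∷ merged e w w₀)
  blank∷merged-unique e inj e≢blank w w₀ = All.tabulate blank∉ ∷ merged-unique e inj w w₀
    where
    blank∉ : ∀ {x} → x ∈ merged e w w₀ → blank ≢ x
    blank∉ x∈ eq with ∈-merged e w w₀ x∈
    ... | i , a , refl = e≢blank i a (sym eq)

  blank∷merged-⊆ : ∀ {k} (e : Code k) w w₀ padding → blank ∷ merged e w w₀ ⊆ block e w padding ++ block e w₀ padding
  blank∷merged-⊆ e w w₀ padding (here refl) = here refl
  blank∷merged-⊆ e w w₀ padding (there x∈) with merged-⊆ e w w₀ x∈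
  ... | inj₁ x∈w  = there (++⁺ˡ (++⁺ˡ x∈w))
  ... | inj₂ x∈w₀ = ++⁺ʳ (block e w padding) (there (++⁺ˡ x∈w₀))

module LowerBound where

  open import Data.Nat as ℕ using (ℕ; zero; suc; _∸_; _^_; z≤n; s≤s)
  import Data.Nat.Properties as ℕ
  open import Data.Fin using (Fin; zero; suc; combine; inject≤; toℕ; fromℕ<)
  open import Data.Fin.Properties using (combine-injective; inject≤-injective; suc-injective; toℕ-fromℕ<)
  open import Data.Vec as Vec using (toList; fromList; cast)
  open import Data.Vec.Properties using (toList-cast; toList∘fromList; toList-replicate)
  open import Data.List using (List; []; _∷_; length; _++_)
  open import Data.List.Properties using (length-++)
  open import Data.List.Membership.Propositional using (_∈_)
  open import Data.List.Relation.Binary.Subset.Propositional using (_⊆_)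
  open import Data.List.Relation.Unary.Any using (here; there)
  import Data.List.Relation.Unary.All as All
  open import Data.List.Relation.Unary.All.Properties using (replicate⁺)
  open import Data.List.Relation.Unary.AllPairs using ([]; _∷_)
  open import Data.Rational using (ℚ; _<_; _≤_; _-_; _+_; _*_; 0ℚ; 1ℚ; NonNegative)
  open import Data.Rational.Properties
    using (<-irrefl; <-≤-trans; *-monoˡ-≤-nonNeg; *-identityʳ; module ≤-Reasoning)
  open import Data.Product using (_×_; proj₁; proj₂)
  open import Data.Empty using (⊥)
  open import Relation.Binary.PropositionalEquality

  open NatEmbedding
  open RationalBounds
  open FiniteSums using (Word)
  open Agreement
  open PowerBounds
  open MultiPass
  open DistinctElements

  listStream : ∀ {u m} (xs : List (Fin u)) → length xs ≡ m → Stream u m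
  listStream xs eq = cast eq (fromList xs)

  toList-listStream : ∀ {u m} (xs : List (Fin u)) (eq : length xs ≡ m) → toList (listStream xs eq) ≡ xs
  toList-listStream xs eq = trans (toList-cast eq (fromList xs)) (toList∘fromList xs)

  module CutAndPaste
    {c : ℚ} (1<c : 1ℚ < c) {n′ p S : ℕ} (A : StreamAlg p S (2 ℕ.* suc n′))
    (correct : (σ : Stream (2 ℕ.* suc n′) (2 ℕ.* suc n′)) →
                 toℚ (F0 σ) ≤ output A σ × output A σ < c * toℚ (F0 σ))
    (m′ : ℕ) (0≤2-c : 0ℚ ≤ toℚ 2 - c) (2≤m[2-c] : toℚ 2 ≤ toℚ (suc m′) * (toℚ 2 - c))
    where

    m q : ℕ
    m = suc m′
    q = suc (2 ℕ.* m′)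

    r : ℕ
    r = n′ ℕ./ (m ℕ.* m)

    rm²≤n′ : r ℕ.* (m ℕ.* m) ℕ.≤ n′
    rm²≤n′ = Data.Nat.DivMod.m/n*n≤m n′ (m ℕ.* m)
      where import Data.Nat.DivMod

    n′<[1+r]m² : suc n′ ℕ.≤ suc r ℕ.* (m ℕ.* m)
    n′<[1+r]m² = begin
      suc n′                                 ≡⟨ cong suc (m≡m%n+[m/n]*n n′ (m ℕ.* m)) ⟩
      suc (n′ % (m ℕ.* m) ℕ.+ r ℕ.* (m ℕ.* m)) ≤⟨ ℕ.+-monoˡ-≤ _ (m%n<n n′ (m ℕ.* m)) ⟩
      suc r ℕ.* (m ℕ.* m)                    ∎
      where
      open ℕ.≤-Reasoning
      open import Data.Nat.DivMod using (_%_; m%n<n; m≡m%n+[m/n]*n)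

    k padding : ℕ
    k = m ℕ.* r
    padding = n′ ∸ k

    k≤n′ : k ℕ.≤ n′
    k≤n′ = ℕ.≤-trans (ℕ.≤-reflexive (ℕ.*-comm m r)) (ℕ.≤-trans (ℕ.*-monoʳ-≤ r (ℕ.m≤m*n m m)) rm²≤n′)

    kq≤n′+[1+n′] : k ℕ.* q ℕ.≤ n′ ℕ.+ suc (n′ ℕ.+ 0)
    kq≤n′+[1+n′] = begin
      k ℕ.* q
        ≤⟨ ℕ.*-monoʳ-≤ k (ℕ.≤-trans (ℕ.n≤1+n q) (ℕ.≤-reflexive (sym (ℕ.*-suc 2 m′)))) ⟩
      k ℕ.* (2 ℕ.* m)
        ≡⟨ solve 2 (λ m r → (m :* r) :* (con 2 :* m) := r :* (m :* m) :+ r :* (m :* m)) refl m r ⟩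
      r ℕ.* (m ℕ.* m) ℕ.+ r ℕ.* (m ℕ.* m)
        ≤⟨ ℕ.+-mono-≤ rm²≤n′ (ℕ.m≤n⇒m≤1+n rm²≤n′) ⟩
      n′ ℕ.+ suc n′
        ≡⟨ cong (λ x → n′ ℕ.+ suc x) (ℕ.+-identityʳ n′) ⟨
      n′ ℕ.+ suc (n′ ℕ.+ 0) ∎
      where
      open ℕ.≤-Reasoning
      open import Data.Nat.Solver using (module +-*-Solver)
      open +-*-Solver

    open WordStreams {Fin (2 ℕ.* suc n′)} zero {q}
    open StreamAlg A using (step; init; out)

    code : Code k
    code i a = suc (inject≤ (combine i a) kq≤n′+[1+n′])

    code-injective : Injective₂ code
    code-injective eq = combine-injective _ _ _ _ (inject≤-injective _ _ _ _ (suc-injective eq))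

    half : Word q k → List (Fin (2 ℕ.* suc n′))
    half w = block code w padding

    length-half : ∀ w → length (half w) ≡ suc n′
    length-half w = trans (length-block code w padding) (cong suc (ℕ.m+[n∸m]≡n k≤n′))

    length-half++half : ∀ w w₀ → length (half w ++ half w₀) ≡ 2 ℕ.* suc n′
    length-half++half w w₀ = trans (length-++ (half w))
      (cong₂ ℕ._+_ (length-half w) (trans (length-half w₀) (sym (ℕ.+-identityʳ (suc n′)))))

    σ : Word q k → Word q k → Stream (2 ℕ.* suc n′) (2 ℕ.* suc n′)
    σ w w₀ = listStream (half w ++ half w₀) (length-half++half w w₀)

    toList-σ : ∀ w w₀ → toList (σ w w₀) ≡ half w ++ half w₀
    toList-σ w w₀ = toList-listStream (half w ++ half w₀) (length-half++half w w₀)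

    fingerprint : Word q k → Word (2 ^ S) (p ℕ.* 2)
    fingerprint w = boundaryStates p step init (half w) (half w)

    same-fingerprint⇒same-output : ∀ w w₀ → fingerprint w ≡ fingerprint w₀ → output A (σ w w₀) ≡ output A (σ w w)
    same-fingerprint⇒same-output w w₀ same = cong out (begin
      run (toList (σ w w₀))
        ≡⟨ cong run (toList-σ w w₀) ⟩
      run (half w ++ half w₀)
        ≡⟨ runPasses-splice p step init (half w) (half w) (half w₀) (half w₀) (trans (length-half w) (sym (length-half w₀))) same ⟩
      run (half w ++ half w)
        ≡⟨ cong run (toList-σ w w) ⟨
      run (toList (σ w w))    ∎)
      where
      open ≡-Reasoning
      run : List (Fin (2 ℕ.* suc n′)) → Fin (2 ^ S)
      run = runPasses p step init

    F0-σ-diagonal : ∀ w → F0 (σ w w) ℕ.≤ suc k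
    F0-σ-diagonal w = ℕ.≤-trans
      (F0-≤ (σ w w) (subst (_⊆ zero ∷ encode code w) (sym (toList-σ w w)) (block-++-block-⊆ code w padding)))
      (ℕ.≤-reflexive (cong suc (length-encode code w)))

    F0-σ-mixed : ∀ w w₀ → suc (length (merged code w w₀)) ℕ.≤ F0 (σ w w₀)
    F0-σ-mixed w w₀ = F0-≥ (σ w w₀) (blank∷merged-unique code code-injective (λ _ _ ()) w w₀)
                           (subst (zero ∷ merged code w w₀ ⊆_) (sym (toList-σ w w₀)) (blank∷merged-⊆ code w w₀ padding))

    2[1+k]≤F0-mixed+[1+agreement] : ∀ w w₀ → 2 ℕ.* suc k ℕ.≤ F0 (σ w w₀) ℕ.+ suc (agreement w w₀)
    2[1+k]≤F0-mixed+[1+agreement] w w₀ = begin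
      2 ℕ.* suc k        ≡⟨ solve 1 (λ k → con 2 :* (con 1 :+ k) := con 2 :+ (k :+ k)) refl k ⟩
      2 ℕ.+ (k ℕ.+ k)    ≡⟨ cong (2 ℕ.+_) (length-merged code w w₀) ⟨
      2 ℕ.+ (L ℕ.+ a)    ≡⟨ solve 2 (λ L a → con 2 :+ (L :+ a) := (con 1 :+ L) :+ (con 1 :+ a)) refl L a ⟩
      suc L ℕ.+ suc a    ≤⟨ ℕ.+-monoˡ-≤ (suc a) (F0-σ-mixed w w₀) ⟩
      F0 (σ w w₀) ℕ.+ suc a ∎
      where
      open ℕ.≤-Reasoning
      open import Data.Nat.Solver using (module +-*-Solver)
      open +-*-Solver
      L = length (merged code w w₀)
      a = agreement w w₀

    same-fingerprint⇒F0-mixed<c[1+k] : ∀ w w₀ → fingerprint w ≡ fingerprint w₀ → toℚ (F0 (σ w w₀)) < c * toℚ (suc k)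
    same-fingerprint⇒F0-mixed<c[1+k] w w₀ same = begin-strict
      toℚ (F0 (σ w w₀))      ≤⟨ proj₁ (correct (σ w w₀)) ⟩
      output A (σ w w₀)      ≡⟨ same-fingerprint⇒same-output w w₀ same ⟩
      output A (σ w w)       <⟨ proj₂ (correct (σ w w)) ⟩
      c * toℚ (F0 (σ w w))   ≤⟨ *-monoˡ-≤-nonNeg c {{1<c⇒nonNegative 1<c}} (toℚ-mono-≤ (F0-σ-diagonal w)) ⟩
      c * toℚ (suc k)        ∎
      where open ≤-Reasoning

    2r≤[2-c][1+k] : toℚ 2 * toℚ r ≤ (toℚ 2 - c) * toℚ (suc k)
    2r≤[2-c][1+k] = subst (λ K → toℚ 2 * toℚ r ≤ (toℚ 2 - c) * K) mr+1≡1+k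
                      (2r≤[2-c][mr+1] {c} {toℚ m} {toℚ r} 0≤2-c 2≤m[2-c] (toℚ-mono-≤ (z≤n {r})))
      where
      mr+1≡1+k : toℚ m * toℚ r + 1ℚ ≡ toℚ (suc k)
      mr+1≡1+k = sym (trans (cong toℚ (ℕ.+-comm 1 k)) (trans (toℚ-homo-+ k 1) (cong (_+ 1ℚ) (toℚ-homo-* m r))))

    same-fingerprint⇒2r≤agreement : ∀ w w₀ → fingerprint w ≡ fingerprint w₀ → 2 ℕ.* r ℕ.≤ agreement w w₀
    same-fingerprint⇒2r≤agreement w w₀ same = ℕ.≮⇒≥ λ a<2r →
      <-irrefl refl (<-≤-trans (x<cK∧r≤[2-c]K⇒x+r<2K {c} {K} {X} {toℚ 2 * toℚ r} X<cK 2r≤[2-c][1+k]) (2K≤X+2r a<2r))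
      where
      K X : ℚ
      K = toℚ (suc k)
      X = toℚ (F0 (σ w w₀))
      X<cK : X < c * K
      X<cK = same-fingerprint⇒F0-mixed<c[1+k] w w₀ same
      2K≤X+2r : agreement w w₀ ℕ.< 2 ℕ.* r → toℚ 2 * K ≤ X + toℚ 2 * toℚ r
      2K≤X+2r a<2r = begin
        toℚ 2 * K
          ≡⟨ toℚ-homo-* 2 (suc k) ⟨
        toℚ (2 ℕ.* suc k)
          ≤⟨ toℚ-mono-≤ (ℕ.≤-trans (2[1+k]≤F0-mixed+[1+agreement] w w₀) (ℕ.+-monoʳ-≤ (F0 (σ w w₀)) a<2r)) ⟩
        toℚ (F0 (σ w w₀) ℕ.+ 2 ℕ.* r)
          ≡⟨ toℚ-homo-+ (F0 (σ w w₀)) (2 ℕ.* r) ⟩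
        X + toℚ (2 ℕ.* r)
          ≡⟨ cong (X +_) (toℚ-homo-* 2 r) ⟩
        X + toℚ 2 * toℚ r                        ∎
        where open ≤-Reasoning

    2r≤S[2p]+r : 2 ℕ.* r ℕ.≤ S ℕ.* (p ℕ.* 2) ℕ.+ r
    2r≤S[2p]+r = 2^-cancel-≤ (ℕ.*-cancelʳ-≤ (2 ^ (2 ℕ.* r)) _ (q ^ k) {{ℕ.m^n≢0 q k}} (begin
      2 ^ (2 ℕ.* r) ℕ.* q ^ k
        ≤⟨ agreement-packing q k (2 ^ S) (p ℕ.* 2) (2 ℕ.* r) fingerprint same-fingerprint⇒2r≤agreement ⟩
      (2 ^ S) ^ (p ℕ.* 2) ℕ.* suc q ^ k
        ≤⟨ ℕ.*-monoʳ-≤ ((2 ^ S) ^ (p ℕ.* 2)) ([2m]^[mr]≤2^r[2m-1]^[mr] m′ r) ⟩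
      (2 ^ S) ^ (p ℕ.* 2) ℕ.* (2 ^ r ℕ.* q ^ k)
        ≡⟨ cong (ℕ._* (2 ^ r ℕ.* q ^ k)) (ℕ.^-*-assoc 2 S (p ℕ.* 2)) ⟩
      2 ^ (S ℕ.* (p ℕ.* 2)) ℕ.* (2 ^ r ℕ.* q ^ k)
        ≡⟨ ℕ.*-assoc (2 ^ (S ℕ.* (p ℕ.* 2))) (2 ^ r) (q ^ k) ⟨
      2 ^ (S ℕ.* (p ℕ.* 2)) ℕ.* 2 ^ r ℕ.* q ^ k
        ≡⟨ cong (ℕ._* q ^ k) (ℕ.^-distribˡ-+-* 2 (S ℕ.* (p ℕ.* 2)) r) ⟨
      2 ^ (S ℕ.* (p ℕ.* 2) ℕ.+ r) ℕ.* q ^ k          ∎))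
      where open ℕ.≤-Reasoning

    r≤S[2p] : r ℕ.≤ S ℕ.* (p ℕ.* 2)
    r≤S[2p] = ℕ.+-cancelʳ-≤ r r _ (subst (ℕ._≤ S ℕ.* (p ℕ.* 2) ℕ.+ r) (cong (r ℕ.+_) (ℕ.+-identityʳ r)) 2r≤S[2p]+r)

    n≤[1+2Sp]m² : suc n′ ℕ.≤ suc (S ℕ.* (p ℕ.* 2)) ℕ.* (m ℕ.* m)
    n≤[1+2Sp]m² = ℕ.≤-trans n′<[1+r]m² (ℕ.*-monoˡ-≤ (m ℕ.* m) (s≤s r≤S[2p]))

  zero-space-impossible : ∀ {c} → 1ℚ < c → c < toℚ 2 → ∀ {n′ p} (A : StreamAlg p 0 (2 ℕ.* suc n′)) →
                          ((σ : Stream (2 ℕ.* suc n′) (2 ℕ.* suc n′)) →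
                             toℚ (F0 σ) ≤ output A σ × output A σ < c * toℚ (F0 σ)) →
                          ⊥
  zero-space-impossible {c} 1<c c<2 {n′} A correct = <-irrefl refl (begin-strict
    toℚ 2                 ≤⟨ toℚ-mono-≤ F0-σ₂≥2 ⟩
    toℚ (F0 σ₂)           ≤⟨ proj₁ (correct σ₂) ⟩
    output A σ₂           ≡⟨ cong (StreamAlg.out A) (single-state _ _) ⟩
    output A σ₁           <⟨ proj₂ (correct σ₁) ⟩
    c * toℚ (F0 σ₁)       ≤⟨ *-monoˡ-≤-nonNeg c (toℚ-mono-≤ F0-σ₁≤1) ⟩
    c * toℚ 1             ≡⟨ *-identityʳ c ⟩
    c                     <⟨ c<2 ⟩
    toℚ 2                 ∎)
    where
    open ≤-Reasoning
    instance
      _ : NonNegative c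
      _ = 1<c⇒nonNegative 1<c
    single-state : (s t : Fin 1) → s ≡ t
    single-state zero zero = refl
    1<2[1+n′] : 1 ℕ.< 2 ℕ.* suc n′
    1<2[1+n′] = ℕ.*-monoʳ-≤ 2 (s≤s (z≤n {n′}))
    one : Fin (2 ℕ.* suc n′)
    one = fromℕ< 1<2[1+n′]
    σ₁ σ₂ : Stream (2 ℕ.* suc n′) (2 ℕ.* suc n′)
    σ₁ = Vec.replicate _ zero
    σ₂ = one Vec.∷ Vec.replicate _ zero
    F0-σ₁≤1 : F0 σ₁ ℕ.≤ 1
    F0-σ₁≤1 = F0-≤ σ₁ {zero ∷ []} λ {x} x∈ →
      here (All.lookup (replicate⁺ {P = _≡ zero} (2 ℕ.* suc n′) refl) (subst (x ∈_) (toList-replicate (2 ℕ.* suc n′) zero) x∈))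
    F0-σ₂≥2 : 2 ℕ.≤ F0 σ₂
    F0-σ₂≥2 = F0-≥ σ₂ {one ∷ zero ∷ []} (All.tabulate one∉ ∷ All.tabulate (λ ()) ∷ []) one∷zero⊆σ₂
      where
      one∉ : ∀ {x} → x ∈ zero ∷ [] → one ≢ x
      one∉ (here refl) one≡0 with trans (sym (toℕ-fromℕ< 1<2[1+n′])) (cong toℕ one≡0)
      ... | ()
      blank : Fin (2 ℕ.* suc n′)
      blank = zero
      -- The tail has length n′ + suc (n′ + 0), which is not syntactically a successor.
      zero∈tail : blank ∈ Vec.toList (Vec.replicate (n′ ℕ.+ suc (n′ ℕ.+ 0)) blank)
      zero∈tail = subst (λ l → blank ∈ Vec.toList (Vec.replicate l blank)) (sym (ℕ.+-suc n′ (n′ ℕ.+ 0))) (here refl)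
      one∷zero⊆σ₂ : ∀ {x} → x ∈ one ∷ zero ∷ [] → x ∈ Vec.toList σ₂
      one∷zero⊆σ₂ (here refl)         = here refl
      one∷zero⊆σ₂ (there (here refl)) = there zero∈tail

open import Data.Nat using (ℕ; _*_)
open import Data.Product using (Σ; _×_)
open import Data.Rational using (ℚ; _<_; _≤_; _-_; 0ℚ; 1ℚ)
open import Data.Rational using () renaming (_*_ to _*q_)

open import Data.Nat using (zero; suc; z≤n; s≤s)
import Data.Nat.Properties as ℕ
open import Data.Integer using (+_; +<+)
open import Data.Rational using (_/_; *<*)
open import Data.Rational.Properties using (≤-trans; ≤-reflexive; <⇒≤)
open import Data.Product using (_,_)
open import Data.Empty using (⊥-elim)
open import Relation.Binary.PropositionalEquality using (_≡_; refl; cong)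
open NatEmbedding
open RationalBounds
open LowerBound

1+S[2p]≤3Sp : ∀ S p → 1 Data.Nat.≤ S * p → suc (S * (p * 2)) Data.Nat.≤ 3 * (S * p)
1+S[2p]≤3Sp S p 1≤Sp = ℕ.≤-trans (ℕ.≤-reflexive (cong suc S[2p]≡2Sp)) (ℕ.+-monoˡ-≤ (2 * (S * p)) 1≤Sp)
  where
  open import Data.Nat.Solver using (module +-*-Solver)
  open +-*-Solver
  S[2p]≡2Sp : S * (p * 2) ≡ 2 * (S * p)
  S[2p]≡2Sp = solve 2 (λ S p → S :* (p :* con 2) := con 2 :* (S :* p)) refl S p

space-lower-bound : (c : ℚ) → 1ℚ < c → c < toℚ 2 →
                    (n p S : ℕ) → 1 Data.Nat.≤ n → 1 Data.Nat.≤ p →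
                    (A : StreamAlg p S (2 * n)) →
                    ((σ : Stream (2 * n) (2 * n)) → (toℚ (F0 σ) ≤ output A σ) × (output A σ < c *q toℚ (F0 σ))) →
                    (+ 1 / 27) *q (toℚ n *q ((toℚ 2 - c) *q (toℚ 2 - c))) ≤ toℚ S *q toℚ p
space-lower-bound c 1<c c<2 (suc n′) p zero     _ _   A correct = ⊥-elim (zero-space-impossible 1<c c<2 A correct)
space-lower-bound c 1<c c<2 (suc n′) p (suc S′) _ 1≤p A correct =
  let 0<2-c , 2-c≤1 = 1<c<2⇒0<2-c≤1 1<c c<2
      m′ , 2≤m[2-c] , m[2-c]≤3 = choose-scale (toℚ 2 - c) 0<2-c 2-c≤1
      m = suc m′
      n≤3Spm² : suc n′ Data.Nat.≤ 3 * (S * p) * (m * m)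
      n≤3Spm² = ℕ.≤-trans (CutAndPaste.n≤[1+2Sp]m² {c} 1<c {n′} {p} {S} A correct m′ (<⇒≤ 0<2-c) 2≤m[2-c])
                          (ℕ.*-monoˡ-≤ (m * m) (1+S[2p]≤3Sp S p (ℕ.*-mono-≤ (s≤s (z≤n {S′})) 1≤p)))
  in ≤-trans (n≤3Pm²∧me≤3⇒ne²≤27P (suc n′) (S * p) m {toℚ 2 - c} (<⇒≤ 0<2-c) n≤3Spm² m[2-c]≤3)
             (≤-reflexive (toℚ-homo-* S p))
  where
  S = suc S′

theorem4 : Σ ℚ (λ K → (0ℚ < K) ×
    ((c : ℚ) → 1ℚ < c → c < toℚ 2 →
     (n p S : ℕ) → 1 Data.Nat.≤ n → 1 Data.Nat.≤ p →
     (A : StreamAlg p S (2 * n)) →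
     ((σ : Stream (2 * n) (2 * n)) →
        (toℚ (F0 σ) ≤ output A σ) × (output A σ < c *q toℚ (F0 σ))) →
     K *q (toℚ n *q ((toℚ 2 - c) *q (toℚ 2 - c))) ≤ toℚ S *q toℚ p))
theorem4 = + 1 / 27 , *<* (+<+ (s≤s z≤n)) , space-lower-bound
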